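{- Let $\varepsilon\in(0,1)$ with $1/\varepsilon\in\mathbb{N}$, let $k\in\mathbb{N}$, $\delta=\varepsilon^k$, and let $0<\mu<\delta$. Consider a strip packing instance with strip width $W$, item set $I$ and optimal packing height $\mathrm{OPT}$, and let $L,T,V\subseteq I$ be as defined in the context. Then there is a feasible packing of height at most $(1+2\varepsilon)\mathrm{OPT}$ of the modified instance obtained as follows: every item $i\in L\cup T\cup V$ whose height satisfies $\varepsilon^{l-1}\mathrm{OPT}>h_i\ge \varepsilon^{l}\mathrm{OPT}$ for some $l\in\mathbb{N}$ with $l\le k$ is given the new height $h_i'=k_i\,\varepsilon^{l+1}\mathrm{OPT}\ge h_i$ for some integer $k_i\in\{1/\varepsilon,\dots,1/\varepsilon^2\}$ (its width unchanged), all other items keep their sizes; moreover, in this packing the $y$-coordinate of each such item $i$ is an integer multiple of $\varepsilon^{l+1}\mathrm{OPT}$.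
   Context: A strip packing instance consists of a strip width $W\in\mathbb{N}$ and a finite set $I$ of items, each $i\in I$ with width $w_i\le W$ and height $h_i$ (positive integers). A packing assigns each item a bottom-left corner $(x_i,y_i)$ with $x_i,y_i\ge 0$ and $x_i\le W-w_i$; it is feasible if the open rectangles $(x_i,x_i+w_i)\times(y_i,y_i+h_i)$ are pairwise disjoint; its height is $\max_i (y_i+h_i)$; $\mathrm{OPT}$ is the minimum height of a feasible packing. With parameters $\delta>\mu>0$ and $\varepsilon$: large items $L=\{i\in I: h_i\ge\delta\mathrm{OPT},\ w_i\ge\delta W\}$; tall items $T=\{i\in I\setminus L: h_i\ge(1/3+\varepsilon)\mathrm{OPT}\}$; vertical items $V=\{i\in I\setminus T: h_i\ge\delta\mathrm{OPT},\ w_i\le\mu W\}$.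
   Formalization: The parameter μ ranges over the rationals, and all packings, including those over which OPT is the minimum height, have rational coordinates. -}

module Defs where

open import Data.Nat as ℕ using (ℕ; zero; suc)
open import Data.Integer as ℤ using (ℤ; +_)
open import Data.Rational using (ℚ; 0ℚ; 1ℚ; _+_; _*_; _≤_; _<_; _⊔_; _/_)
open import Data.Fin using (Fin; zero; suc)
open import Data.Product using (_×_; Σ; ∃; ∃-syntax; _,_)
open import Data.Sum using (_⊎_)
open import Relation.Nullary using (¬_)
open import Relation.Binary.PropositionalEquality using (_≡_)

ℕ→ℚ : ℕ → ℚ
ℕ→ℚ n = (+ n) / 1

ℤ→ℚ : ℤ → ℚ
ℤ→ℚ z = z / 1

_^ℚ_ : ℚ → ℕ → ℚ
q ^ℚ zero = 1ℚ
q ^ℚ suc l = q * (q ^ℚ l)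

-- maximum of finitely many rationals together with 0 (height of the empty packing is 0)
maxFin : (n : ℕ) → (Fin n → ℚ) → ℚ
maxFin zero f = 0ℚ
maxFin (suc n) f = f zero ⊔ maxFin n (λ i → f (suc i))

record Instance : Set where
  field
    W : ℕ
    n : ℕ
    w : Fin n → ℕ
    h : Fin n → ℕ
    w-pos : ∀ i → 1 ℕ.≤ w i
    h-pos : ∀ i → 1 ℕ.≤ h i
    w≤W : ∀ i → w i ℕ.≤ W

InOpenRect : (x y a b px py : ℚ) → Set
InOpenRect x y a b px py = (x < px × px < x + a) × (y < py × py < y + b)

record Packing (W : ℕ) (n : ℕ) (wq hq : Fin n → ℚ) : Set where
  field
    x : Fin n → ℚ
    y : Fin n → ℚ
    x≥0 : ∀ i → 0ℚ ≤ x i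
    y≥0 : ∀ i → 0ℚ ≤ y i
    x≤W-w : ∀ i → x i + wq i ≤ ℕ→ℚ W
    disjoint : ∀ i j → ¬ (i ≡ j) → ∀ (px py : ℚ) →
      ¬ (InOpenRect (x i) (y i) (wq i) (hq i) px py
         × InOpenRect (x j) (y j) (wq j) (hq j) px py)

height : ∀ {W n wq hq} → Packing W n wq hq → ℚ
height {n = n} {hq = hq} p = maxFin n (λ i → Packing.y p i + hq i)

module _ (I : Instance) where
  open Instance I

  wℚ : Fin n → ℚ
  wℚ i = ℕ→ℚ (w i)

  hℚ : Fin n → ℚ
  hℚ i = ℕ→ℚ (h i)

  IsOPT : ℚ → Set
  IsOPT OPT = Σ (Packing W n wℚ hℚ) (λ p → height p ≡ OPT)
            × (∀ (p : Packing W n wℚ hℚ) → OPT ≤ height p)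

  Large : (δ OPT : ℚ) → Fin n → Set
  Large δ OPT i = δ * OPT ≤ hℚ i × δ * ℕ→ℚ W ≤ wℚ i

  Tall : (δ ε OPT : ℚ) → Fin n → Set
  Tall δ ε OPT i = ¬ Large δ OPT i × ((+ 1 / 3) + ε) * OPT ≤ hℚ i

  Vertical : (δ μ ε OPT : ℚ) → Fin n → Set
  Vertical δ μ ε OPT i = ¬ Tall δ ε OPT i × δ * OPT ≤ hℚ i × wℚ i ≤ μ * ℕ→ℚ W

-- Stretch an optimal packing vertically by the factor s = 1 + 2ε. An item i of height class l
-- (ε^l OPT ≤ h_i < ε^(l-1) OPT) then sits in the band [s y_i, s (y_i + h_i)], which exceeds
-- [y_i, y_i + h_i] by 2ε h_i ≥ 2 ε^(l+1) OPT. Hence both the bottom s y_i and the height h_i can be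
-- rounded up to multiples of the grid unit ε^(l+1) OPT within that band, and the bands of distinct
-- items are disjoint because they are images of disjoint rectangles under the same stretch.
module Submission where

open import Defs
open import Data.Nat as ℕ using (ℕ; NonZero; zero; suc)
open import Data.Nat.Tactic.RingSolver using (solve)
import Data.Nat.Properties as ℕ
import Data.Nat.Coprimality as Coprime
open import Data.Integer as ℤ using (ℤ; +_; -[1+_])
import Data.Integer.Properties as ℤ
open import Data.Rational
  using (ℚ; 0ℚ; 1ℚ; _+_; _*_; _≤_; _<_; _/_; mkℚ; 1/_; *≤*; *<*; positive; nonNegative)
import Data.Rational as ℚ
import Data.Rational.Properties as ℚ
import Data.Rational.Unnormalised.Base as ℚᵘ
open import Data.Rational.Solver using (module +-*-Solver)
open +-*-Solver using (_:+_; _:*_; _:=_; con) renaming (solve to ℚ-solve)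
open import Data.List using ([]; _∷_)
open import Data.Fin using (Fin; zero; suc)
open import Data.Product using (_×_; Σ; ∃-syntax; _,_; proj₁; proj₂)
open import Data.Sum using (_⊎_)
open import Data.Empty using (⊥-elim)
open import Relation.Nullary using (¬_; Dec; yes; no)
open import Relation.Nullary.Decidable using (_×-dec_; _⊎-dec_; ¬?; map′)
open import Relation.Unary using (Decidable)
open import Relation.Binary using (tri<; tri≈; tri>)
open import Relation.Binary.PropositionalEquality
open import Function using (_$_)

*-monoʳ-≤-nonNeg′ : ∀ {p q r} → 0ℚ ≤ r → p ≤ q → p * r ≤ q * r
*-monoʳ-≤-nonNeg′ {r = r} 0≤r = ℚ.*-monoʳ-≤-nonNeg r {{nonNegative 0≤r}}

*-monoˡ-≤-nonNeg′ : ∀ {p q r} → 0ℚ ≤ r → p ≤ q → r * p ≤ r * q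
*-monoˡ-≤-nonNeg′ {r = r} 0≤r = ℚ.*-monoˡ-≤-nonNeg r {{nonNegative 0≤r}}

*-monoˡ-<-pos′ : ∀ {p q r} → 0ℚ < r → p < q → p * r < q * r
*-monoˡ-<-pos′ {r = r} 0<r = ℚ.*-monoˡ-<-pos r {{positive 0<r}}

*-cancelʳ-≤-pos′ : ∀ {p q r} → 0ℚ < r → p * r ≤ q * r → p ≤ q
*-cancelʳ-≤-pos′ {r = r} 0<r = ℚ.*-cancelʳ-≤-pos r {{positive 0<r}}

*-cancelʳ-<-nonNeg′ : ∀ {p q r} → 0ℚ ≤ r → p * r < q * r → p < q
*-cancelʳ-<-nonNeg′ {r = r} 0≤r = ℚ.*-cancelʳ-<-nonNeg r {{nonNegative 0≤r}}

0<1 : 0ℚ < 1ℚ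
0<1 = *<* (ℤ.+<+ (ℕ.s≤s ℕ.z≤n))

/-cong-≃ : ∀ (i j : ℤ) (a b : ℕ) → i ℤ.* + suc b ≡ j ℤ.* + suc a → i / suc a ≡ j / suc b
/-cong-≃ i j a b eq = ℚ.fromℚᵘ-cong {ℚᵘ.mkℚᵘ i a} {ℚᵘ.mkℚᵘ j b} (ℚᵘ.*≡* eq)

ℕ→ℚ-normal : ∀ n → ℕ→ℚ n ≡ mkℚ (+ n) 0 (Coprime.sym (Coprime.1-coprimeTo n))
ℕ→ℚ-normal n = ℚ.normalize-coprime (Coprime.sym (Coprime.1-coprimeTo n))

ℕ→ℚ-+ : ∀ a b → ℕ→ℚ (a ℕ.+ b) ≡ ℕ→ℚ a + ℕ→ℚ b
ℕ→ℚ-+ a b rewrite ℕ→ℚ-normal a | ℕ→ℚ-normal b =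
  /-cong-≃ (+ (a ℕ.+ b)) (+ a ℤ.* + 1 ℤ.+ + b ℤ.* + 1) 0 0
    (cong (ℤ._* + 1) (trans (ℤ.pos-+ a b)
      (sym (cong₂ ℤ._+_ (ℤ.*-identityʳ (+ a)) (ℤ.*-identityʳ (+ b))))))

ℕ→ℚ-* : ∀ a b → ℕ→ℚ (a ℕ.* b) ≡ ℕ→ℚ a * ℕ→ℚ b
ℕ→ℚ-* a b rewrite ℕ→ℚ-normal a | ℕ→ℚ-normal b =
  /-cong-≃ (+ (a ℕ.* b)) (+ a ℤ.* + b) 0 0 (cong (ℤ._* + 1) (ℤ.pos-* a b))

ℕ→ℚ-mono-≤ : ∀ {a b} → a ℕ.≤ b → ℕ→ℚ a ≤ ℕ→ℚ b
ℕ→ℚ-mono-≤ {a} {b} a≤b rewrite ℕ→ℚ-normal a | ℕ→ℚ-normal b =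
  *≤* (subst₂ ℤ._≤_ (sym (ℤ.*-identityʳ (+ a))) (sym (ℤ.*-identityʳ (+ b))) (ℤ.+≤+ a≤b))

ℕ→ℚ-cancel-≤ : ∀ {a b} → ℕ→ℚ a ≤ ℕ→ℚ b → a ℕ.≤ b
ℕ→ℚ-cancel-≤ {a} {b} a≤b rewrite ℕ→ℚ-normal a | ℕ→ℚ-normal b =
  ℤ.drop‿+≤+ (subst₂ ℤ._≤_ (ℤ.*-identityʳ (+ a)) (ℤ.*-identityʳ (+ b)) (ℚ.drop-*≤* a≤b))

ℕ→ℚ-cancel-< : ∀ {a b} → ℕ→ℚ a < ℕ→ℚ b → a ℕ.< b
ℕ→ℚ-cancel-< {a} {b} a<b rewrite ℕ→ℚ-normal a | ℕ→ℚ-normal b =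
  ℤ.drop‿+<+ (subst₂ ℤ._<_ (ℤ.*-identityʳ (+ a)) (ℤ.*-identityʳ (+ b)) (ℚ.drop-*<* a<b))

ℕ→ℚ-nonNeg : ∀ n → 0ℚ ≤ ℕ→ℚ n
ℕ→ℚ-nonNeg n = ℕ→ℚ-mono-≤ {0} {n} ℕ.z≤n

ℕ→ℚ-suc-* : ∀ n u → ℕ→ℚ (suc n) * u ≡ u + ℕ→ℚ n * u
ℕ→ℚ-suc-* n u = begin
  ℕ→ℚ (1 ℕ.+ n) * u       ≡⟨ cong (_* u) (ℕ→ℚ-+ 1 n) ⟩
  (1ℚ + ℕ→ℚ n) * u        ≡⟨ ℚ.*-distribʳ-+ u 1ℚ (ℕ→ℚ n) ⟩
  1ℚ * u + ℕ→ℚ n * u      ≡⟨ cong (_+ ℕ→ℚ n * u) (ℚ.*-identityˡ u) ⟩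
  u + ℕ→ℚ n * u           ∎
  where open ≡-Reasoning

ℕ→ℚ-unbounded : ∀ r → ∃[ N ] r ≤ ℕ→ℚ N
ℕ→ℚ-unbounded (mkℚ (+ a) d c) = a , subst (mkℚ (+ a) d c ≤_) (sym (ℕ→ℚ-normal a))
  (*≤* (subst₂ ℤ._≤_ (ℤ.pos-* a 1) (ℤ.pos-* a (suc d))
    (ℤ.+≤+ (ℕ.*-monoʳ-≤ a {1} {suc d} (ℕ.s≤s ℕ.z≤n)))))
ℕ→ℚ-unbounded (mkℚ -[1+ a ] d c) = 0 , *≤* (ℤ.≤-trans (ℤ.≤-reflexive (ℤ.*-identityʳ -[1+ a ])) ℤ.-≤+)

archimedean : ∀ q {u} → 0ℚ < u → ∃[ N ] q ≤ ℕ→ℚ N * u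
archimedean q {u} 0<u = N , subst (_≤ ℕ→ℚ N * u) q/u*u≡q (*-monoʳ-≤-nonNeg′ (ℚ.<⇒≤ 0<u) q/u≤N)
  where
  instance
    u≢0 : ℚ.NonZero u
    u≢0 = ℚ.pos⇒nonZero u {{positive 0<u}}
  N = proj₁ (ℕ→ℚ-unbounded (q * 1/ u))
  q/u≤N = proj₂ (ℕ→ℚ-unbounded (q * 1/ u))
  q/u*u≡q : q * 1/ u * u ≡ q
  q/u*u≡q = trans (ℚ.*-assoc q (1/ u) u) (trans (cong (q *_) (ℚ.*-inverseˡ u)) (ℚ.*-identityʳ q))

RoundedUp : ℚ → ℚ → Set
RoundedUp q u = ∃[ n ] q ≤ ℕ→ℚ n * u × ℕ→ℚ n * u < q + u

-- Count down from a multiple above q (given by the Archimedean property) to the least one.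
roundUp : ∀ {q u} → 0ℚ ≤ q → 0ℚ < u → RoundedUp q u
roundUp {q} {u} 0≤q 0<u = descend (proj₁ (archimedean q 0<u)) (proj₂ (archimedean q 0<u))
  where
  descend : ∀ N → q ≤ ℕ→ℚ N * u → RoundedUp q u
  descend zero q≤0 = zero , q≤0 , ℚ.<-≤-trans
    (subst (_< u) (sym (ℚ.*-zeroˡ u)) 0<u)
    (subst (_≤ q + u) (ℚ.+-identityˡ u) (ℚ.+-monoˡ-≤ u 0≤q))
  descend (suc N) q≤N+1 with q ℚ.≤? ℕ→ℚ N * u
  ... | yes q≤N = descend N q≤N
  ... | no q≰N  = suc N , q≤N+1 , subst (_< q + u) (sym (ℕ→ℚ-suc-* N u))
    (subst (u + ℕ→ℚ N * u <_) (ℚ.+-comm u q) (ℚ.+-monoʳ-< u (ℚ.≰⇒> q≰N)))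

maxFin-upperBound : ∀ n (f : Fin n → ℚ) i → f i ≤ maxFin n f
maxFin-upperBound (suc n) f zero    = ℚ.p≤p⊔q (f zero) _
maxFin-upperBound (suc n) f (suc i) =
  ℚ.≤-trans (maxFin-upperBound n (λ j → f (suc j)) i) (ℚ.p≤q⊔p (f zero) _)

maxFin-least : ∀ n (f : Fin n → ℚ) {c} → 0ℚ ≤ c → (∀ i → f i ≤ c) → maxFin n f ≤ c
maxFin-least zero    f 0≤c f≤c = 0≤c
maxFin-least (suc n) f 0≤c f≤c =
  ℚ.⊔-lub (f≤c zero) (maxFin-least n (λ j → f (suc j)) 0≤c (λ j → f≤c (suc j)))

maxFin-nonNeg : ∀ n (f : Fin n → ℚ) → 0ℚ ≤ maxFin n f
maxFin-nonNeg zero    f = ℚ.≤-refl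
maxFin-nonNeg (suc n) f = ℚ.≤-trans (maxFin-nonNeg n (λ j → f (suc j))) (ℚ.p≤q⊔p (f zero) _)

module _ {W n : ℕ} {wq hq : Fin n → ℚ} (p : Packing W n wq hq) {s : ℚ} (0<s : 0ℚ < s)
         (y′ h′ : Fin n → ℚ)
         (bottom : ∀ i → s * Packing.y p i ≤ y′ i)
         (top : ∀ i → y′ i + h′ i ≤ s * (Packing.y p i + hq i)) where
  open Packing p

  private
    instance
      s≢0 : ℚ.NonZero s
      s≢0 = ℚ.pos⇒nonZero s {{positive 0<s}}

    0<1/s : 0ℚ < 1/ s
    0<1/s = ℚ.positive⁻¹ (1/ s) {{ℚ.1/pos⇒pos s {{positive 0<s}}}}

    s*a/s≡a : ∀ a → s * a * 1/ s ≡ a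
    s*a/s≡a a = trans (ℚ.*-assoc s a (1/ s))
      (trans (cong (s *_) (ℚ.*-comm a (1/ s)))
        (trans (sym (ℚ.*-assoc s (1/ s) a)) (trans (cong (_* a) (ℚ.*-inverseʳ s)) (ℚ.*-identityˡ a))))

    s*y≥0 : ∀ i → 0ℚ ≤ s * y i
    s*y≥0 i = subst (_≤ s * y i) (ℚ.*-zeroʳ s) (*-monoˡ-≤-nonNeg′ (ℚ.<⇒≤ 0<s) (y≥0 i))

    unstretch : ∀ i px py → InOpenRect (x i) (y′ i) (wq i) (h′ i) px py →
                InOpenRect (x i) (y i) (wq i) (hq i) px (py * 1/ s)
    unstretch i px py (inside-x , y′<py , py<y′+h′) = inside-x ,
      subst (_< py * 1/ s) (s*a/s≡a (y i)) (*-monoˡ-<-pos′ 0<1/s (ℚ.≤-<-trans (bottom i) y′<py)) ,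
      subst (py * 1/ s <_) (s*a/s≡a (y i + hq i)) (*-monoˡ-<-pos′ 0<1/s (ℚ.<-≤-trans py<y′+h′ (top i)))

  stretch : Packing W n wq h′
  stretch = record
    { x = x
    ; y = y′
    ; x≥0 = x≥0
    ; y≥0 = λ i → ℚ.≤-trans (s*y≥0 i) (bottom i)
    ; x≤W-w = x≤W-w
    ; disjoint = λ i j i≢j px py (in-i , in-j) →
        disjoint i j i≢j px (py * 1/ s) (unstretch i px py in-i , unstretch j px py in-j)
    }

  height-stretch : height stretch ≤ s * height p
  height-stretch = maxFin-least n (λ i → y′ i + h′ i)
    (subst (_≤ s * height p) (ℚ.*-zeroʳ s) (*-monoˡ-≤-nonNeg′ (ℚ.<⇒≤ 0<s) (maxFin-nonNeg n _)))
    (λ i → ℚ.≤-trans (top i)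
      (*-monoˡ-≤-nonNeg′ (ℚ.<⇒≤ 0<s) (maxFin-upperBound n (λ j → y j + hq j) i)))

module _ {ε : ℚ} (0<ε : 0ℚ < ε) where

  ^ℚ-pos : ∀ l → 0ℚ < ε ^ℚ l
  ^ℚ-pos zero    = 0<1
  ^ℚ-pos (suc l) = subst (_< ε * ε ^ℚ l) (ℚ.*-zeroˡ (ε ^ℚ l)) (*-monoˡ-<-pos′ (^ℚ-pos l) 0<ε)

  ^ℚ-antitone : ε ≤ 1ℚ → ∀ {a b} → a ℕ.≤ b → ε ^ℚ b ≤ ε ^ℚ a
  ^ℚ-antitone ε≤1 {a} {b} a≤b = subst (λ c → ε ^ℚ c ≤ ε ^ℚ a) (ℕ.m∸n+n≡m a≤b) (descent (b ℕ.∸ a))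
    where
    descent : ∀ d → ε ^ℚ (d ℕ.+ a) ≤ ε ^ℚ a
    descent zero    = ℚ.≤-refl
    descent (suc d) = ℚ.≤-trans
      (subst (ε * ε ^ℚ (d ℕ.+ a) ≤_) (ℚ.*-identityˡ _) (*-monoʳ-≤-nonNeg′ (ℚ.<⇒≤ (^ℚ-pos (d ℕ.+ a))) ε≤1))
      (descent d)

module _ (n : ℕ) where

  1/suc-normal : + 1 / suc n ≡ mkℚ (+ 1) n (Coprime.1-coprimeTo (suc n))
  1/suc-normal = ℚ.normalize-coprime (Coprime.1-coprimeTo (suc n))

  1/suc-pos : 0ℚ < + 1 / suc n
  1/suc-pos rewrite 1/suc-normal = *<* (ℤ.+<+ (ℕ.s≤s ℕ.z≤n))

  1/suc-≤1 : + 1 / suc n ≤ 1ℚ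
  1/suc-≤1 rewrite 1/suc-normal = *≤* (ℤ.+≤+ (ℕ.s≤s ℕ.z≤n))

  1/suc-inverse : + 1 / suc n * ℕ→ℚ (suc n) ≡ 1ℚ
  1/suc-inverse rewrite ℕ→ℚ-normal (suc n) | 1/suc-normal =
    /-cong-≃ (+ 1 ℤ.* + suc n) (+ 1) (n ℕ.* 1) 0
      (trans (ℤ.*-identityʳ _) (cong (λ a → + 1 ℤ.* + suc a) (sym (ℕ.*-identityʳ n))))

  2/suc≡1/suc+1/suc : + 2 / suc n ≡ + 1 / suc n + + 1 / suc n
  2/suc≡1/suc+1/suc rewrite 1/suc-normal =
    /-cong-≃ (+ 2) (+ 1 ℤ.* + suc n ℤ.+ + 1 ℤ.* + suc n) n (n ℕ.+ n ℕ.* suc n)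
      (cong +_ (solve (n ∷ [])))

Large? : ∀ I δ OPT → Decidable (Large I δ OPT)
Large? I δ OPT i = (δ * OPT ℚ.≤? hℚ I i) ×-dec (δ * ℕ→ℚ (Instance.W I) ℚ.≤? wℚ I i)

Tall? : ∀ I δ ε OPT → Decidable (Tall I δ ε OPT)
Tall? I δ ε OPT i = ¬? (Large? I δ OPT i) ×-dec ((+ 1 / 3 + ε) * OPT ℚ.≤? hℚ I i)

Vertical? : ∀ I δ μ ε OPT → Decidable (Vertical I δ μ ε OPT)
Vertical? I δ μ ε OPT i = ¬? (Tall? I δ ε OPT i)
  ×-dec ((δ * OPT ℚ.≤? hℚ I i) ×-dec (wℚ I i ℚ.≤? μ * ℕ→ℚ (Instance.W I)))

-- ε = 1/m with m = suc m′; the items in S are the ones to be rounded.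
module Rounding (m′ k : ℕ) (I : Instance) (OPT : ℚ)
                (p₀ : Packing (Instance.W I) (Instance.n I) (wℚ I) (hℚ I)) (height-p₀ : height p₀ ≡ OPT)
                {S : Fin (Instance.n I) → Set} (S? : Decidable S) where
  open Instance I
  open Packing p₀ using (y; y≥0)

  m : ℕ
  m = suc m′

  M ε s : ℚ
  M = ℕ→ℚ m
  ε = + 1 / m
  s = ℕ→ℚ 1 + + 2 / m

  0<ε : 0ℚ < ε
  0<ε = 1/suc-pos m′

  s≡1+ε+ε : s ≡ 1ℚ + (ε + ε)
  s≡1+ε+ε = cong (λ t → 1ℚ + t) (2/suc≡1/suc+1/suc m′)

  0<s : 0ℚ < s
  0<s = subst (0ℚ <_) (sym s≡1+ε+ε)
    (ℚ.<-≤-trans 0<1 (subst (_≤ 1ℚ + (ε + ε)) (ℚ.+-identityʳ 1ℚ)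
      (ℚ.+-monoʳ-≤ 1ℚ (ℚ.+-mono-≤ (ℚ.<⇒≤ 0<ε) (ℚ.<⇒≤ 0<ε)))))

  0≤OPT : 0ℚ ≤ OPT
  0≤OPT = subst (0ℚ ≤_) height-p₀ (maxFin-nonNeg n _)

  top≤OPT : ∀ i → y i + hℚ I i ≤ OPT
  top≤OPT i = subst (y i + hℚ I i ≤_) height-p₀ (maxFin-upperBound n (λ j → y j + hℚ I j) i)

  0<OPT : Fin n → 0ℚ < OPT
  0<OPT i = ℚ.<-≤-trans 0<1 (ℚ.≤-trans (ℕ→ℚ-mono-≤ (h-pos i)) (ℚ.≤-trans h≤top (top≤OPT i)))
    where
    h≤top : hℚ I i ≤ y i + hℚ I i
    h≤top = subst (_≤ y i + hℚ I i) (ℚ.+-identityˡ (hℚ I i)) (ℚ.+-monoˡ-≤ (hℚ I i) (y≥0 i))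

  HeightClass : ℕ → ℚ → Set
  HeightClass l q = ε ^ℚ l * OPT ≤ q × q < ε ^ℚ l * M * OPT

  ε*x*M≡x : ∀ x → ε * x * M ≡ x
  ε*x*M≡x x = begin
    ε * x * M   ≡⟨ ℚ-solve 3 (λ e a b → e :* a :* b := e :* b :* a) refl ε x M ⟩
    ε * M * x   ≡⟨ cong (_* x) (1/suc-inverse m′) ⟩
    1ℚ * x      ≡⟨ ℚ.*-identityˡ x ⟩
    x           ∎
    where open ≡-Reasoning

  HeightClass-disjoint : ∀ {q a b} → a ℕ.< b → HeightClass a q → ¬ HeightClass b q
  HeightClass-disjoint {q} {a} {b} a<b (lo , _) (_ , hi) =
    ℚ.<-irrefl refl (ℚ.<-≤-trans hi (ℚ.≤-trans upper-b≤lower-a lo))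
    where
    upper-b≤lower-a : ε ^ℚ b * M * OPT ≤ ε ^ℚ a * OPT
    upper-b≤lower-a = *-monoʳ-≤-nonNeg′ 0≤OPT (subst (ε ^ℚ b * M ≤_) (ε*x*M≡x (ε ^ℚ a))
      (*-monoʳ-≤-nonNeg′ (ℕ→ℚ-nonNeg m) (^ℚ-antitone 0<ε (1/suc-≤1 m′) a<b)))

  HeightClass-unique : ∀ {q l l′} → HeightClass l q → HeightClass l′ q → l ≡ l′
  HeightClass-unique {l = l} {l′} c c′ with ℕ.<-cmp l l′
  ... | tri< l<l′ _ _ = ⊥-elim (HeightClass-disjoint l<l′ c c′)
  ... | tri≈ _ l≡l′ _ = l≡l′
  ... | tri> _ _ l>l′ = ⊥-elim (HeightClass-disjoint l>l′ c′ c)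

  HeightClass? : ∀ l q → Dec (HeightClass l q)
  HeightClass? l q = (ε ^ℚ l * OPT ℚ.≤? q) ×-dec (q ℚ.<? ε ^ℚ l * M * OPT)

  Rounded : Fin n → Set
  Rounded i = S i × ∃[ l ] l ℕ.≤ k × HeightClass l (hℚ I i)

  Rounded? : Decidable Rounded
  Rounded? i = S? i ×-dec map′
    (λ (l , l<1+k , c) → l , ℕ.s≤s⁻¹ l<1+k , c) (λ (l , l≤k , c) → l , ℕ.s≤s l≤k , c)
    (ℕ.anyUpTo? (λ l → HeightClass? l (hℚ I i)) (suc k))

  level : ∀ {i} → Rounded i → ℕ
  level (_ , l , _) = l

  grid : ℕ → ℚ
  grid l = ε ^ℚ suc l * OPT

  grid-pos : Fin n → ∀ l → 0ℚ < grid l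
  grid-pos i l = subst (_< grid l) (ℚ.*-zeroˡ OPT) (*-monoˡ-<-pos′ (0<OPT i) (^ℚ-pos 0<ε (suc l)))

  grid-≤-ε* : ∀ {l q} → HeightClass l q → grid l ≤ ε * q
  grid-≤-ε* {l} {q} (lo , _) =
    subst (_≤ ε * q) (sym (ℚ.*-assoc ε (ε ^ℚ l) OPT)) (*-monoˡ-≤-nonNeg′ (ℚ.<⇒≤ 0<ε) lo)

  M*grid : ∀ l → M * grid l ≡ ε ^ℚ l * OPT
  M*grid l = trans (ℚ-solve 4 (λ a e x o → a :* (e :* x :* o) := e :* x :* a :* o) refl M ε (ε ^ℚ l) OPT)
    (cong (_* OPT) (ε*x*M≡x (ε ^ℚ l)))

  M*M*grid : ∀ l → M * M * grid l ≡ ε ^ℚ l * M * OPT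
  M*M*grid l = trans (ℚ-solve 2 (λ a g → a :* a :* g := a :* (a :* g)) refl M (grid l))
    (trans (cong (M *_) (M*grid l)) (ℚ-solve 3 (λ a x o → a :* (x :* o) := x :* a :* o) refl M (ε ^ℚ l) OPT))

  roundedHeight : ∀ i → Dec (Rounded i) → ℚ
  roundedHeight i (yes r) = ℕ→ℚ (proj₁ (roundUp (ℕ→ℚ-nonNeg (h i)) (grid-pos i (level r)))) * grid (level r)
  roundedHeight i (no _)  = hℚ I i

  s*y≥0 : ∀ i → 0ℚ ≤ s * y i
  s*y≥0 i = subst (_≤ s * y i) (ℚ.*-zeroʳ s) (*-monoˡ-≤-nonNeg′ (ℚ.<⇒≤ 0<s) (y≥0 i))

  roundedBottom : ∀ i → Dec (Rounded i) → ℚ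
  roundedBottom i (yes r) = ℕ→ℚ (proj₁ (roundUp (s*y≥0 i) (grid-pos i (level r)))) * grid (level r)
  roundedBottom i (no _)  = s * y i

  stretch-excess : ∀ a b → (s * a + b) + (ε * b + ε * b) ≡ s * (a + b)
  stretch-excess a b = sym (begin
    s * (a + b)                    ≡⟨ ℚ.*-distribˡ-+ s a b ⟩
    s * a + s * b                  ≡⟨ cong (λ t → s * a + t * b) s≡1+ε+ε ⟩
    s * a + (1ℚ + (ε + ε)) * b     ≡⟨ ℚ-solve 3 (λ x y e → x :+ (con 1ℚ :+ (e :+ e)) :* y
                                                        := x :+ y :+ (e :* y :+ e :* y)) refl (s * a) b ε ⟩
    (s * a + b) + (ε * b + ε * b)  ∎)
    where open ≡-Reasoning

  bottom-≥ : ∀ i d → s * y i ≤ roundedBottom i d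
  bottom-≥ i (yes r) = proj₁ (proj₂ (roundUp (s*y≥0 i) (grid-pos i (level r))))
  bottom-≥ i (no _)  = ℚ.≤-refl

  top-≤ : ∀ i d → roundedBottom i d + roundedHeight i d ≤ s * (y i + hℚ I i)
  top-≤ i (yes (_ , l , _ , c)) = ℚ.<⇒≤ $ begin-strict
    ℕ→ℚ Y * grid l + ℕ→ℚ K * grid l          <⟨ ℚ.+-mono-< (proj₂ (proj₂ Y-spec)) (proj₂ (proj₂ K-spec)) ⟩
    (s * y i + grid l) + (hᵢ + grid l)        ≡⟨ ℚ-solve 3 (λ a b g → a :+ g :+ (b :+ g) := a :+ b :+ (g :+ g))
                                                   refl (s * y i) hᵢ (grid l) ⟩
    (s * y i + hᵢ) + (grid l + grid l)        ≤⟨ ℚ.+-monoʳ-≤ (s * y i + hᵢ) (ℚ.+-mono-≤ (grid-≤-ε* {l} c) (grid-≤-ε* {l} c)) ⟩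
    (s * y i + hᵢ) + (ε * hᵢ + ε * hᵢ)        ≡⟨ stretch-excess (y i) hᵢ ⟩
    s * (y i + hᵢ)                            ∎
    where
    open ℚ.≤-Reasoning
    hᵢ = hℚ I i
    Y-spec : RoundedUp (s * y i) (grid l)
    Y-spec = roundUp (s*y≥0 i) (grid-pos i l)
    K-spec : RoundedUp hᵢ (grid l)
    K-spec = roundUp (ℕ→ℚ-nonNeg (h i)) (grid-pos i l)
    Y = proj₁ Y-spec
    K = proj₁ K-spec
  top-≤ i (no _) = begin
    s * y i + hᵢ                         ≡⟨ ℚ.+-identityʳ _ ⟨
    (s * y i + hᵢ) + 0ℚ                  ≤⟨ ℚ.+-monoʳ-≤ (s * y i + hᵢ) (ℚ.+-mono-≤ 0≤ε*h 0≤ε*h) ⟩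
    (s * y i + hᵢ) + (ε * hᵢ + ε * hᵢ)   ≡⟨ stretch-excess (y i) hᵢ ⟩
    s * (y i + hᵢ)                       ∎
    where
    open ℚ.≤-Reasoning
    hᵢ = hℚ I i
    0≤ε*h : 0ℚ ≤ ε * hᵢ
    0≤ε*h = subst (_≤ ε * hᵢ) (ℚ.*-zeroʳ ε) (*-monoˡ-≤-nonNeg′ (ℚ.<⇒≤ 0<ε) (ℕ→ℚ-nonNeg (h i)))

  multiplier-bounds : ∀ {l q K} → 0ℚ < grid l → HeightClass l q →
                      q ≤ ℕ→ℚ K * grid l → ℕ→ℚ K * grid l < q + grid l → m ℕ.≤ K × K ℕ.≤ m ℕ.* m
  multiplier-bounds {l} {q} {K} 0<g (lo , hi) q≤Kg Kg<q+g = m≤K , K≤m*m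
    where
    open ℚ.≤-Reasoning
    m≤K : m ℕ.≤ K
    m≤K = ℕ→ℚ-cancel-≤ (*-cancelʳ-≤-pos′ 0<g (begin
      M * grid l        ≡⟨ M*grid l ⟩
      ε ^ℚ l * OPT      ≤⟨ ℚ.≤-trans lo q≤Kg ⟩
      ℕ→ℚ K * grid l    ∎))
    K≤m*m : K ℕ.≤ m ℕ.* m
    K≤m*m = ℕ.s≤s⁻¹ (ℕ→ℚ-cancel-< (*-cancelʳ-<-nonNeg′ (ℚ.<⇒≤ 0<g) (begin-strict
      ℕ→ℚ K * grid l                  <⟨ Kg<q+g ⟩
      q + grid l                      <⟨ ℚ.+-monoˡ-< (grid l) (subst (q <_) (sym (M*M*grid l)) hi) ⟩
      M * M * grid l + grid l         ≡⟨ ℚ.+-comm _ (grid l) ⟩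
      grid l + M * M * grid l         ≡⟨ cong (λ t → grid l + t * grid l) (ℕ→ℚ-* m m) ⟨
      grid l + ℕ→ℚ (m ℕ.* m) * grid l ≡⟨ ℕ→ℚ-suc-* (m ℕ.* m) (grid l) ⟨
      ℕ→ℚ (suc (m ℕ.* m)) * grid l    ∎)))

  h′ y′ : Fin n → ℚ
  h′ i = roundedHeight i (Rounded? i)
  y′ i = roundedBottom i (Rounded? i)

  packing : Packing W n (wℚ I) h′
  packing = stretch p₀ 0<s y′ h′ (λ i → bottom-≥ i (Rounded? i)) (λ i → top-≤ i (Rounded? i))

  height-packing : height packing ≤ s * OPT
  height-packing = subst (λ t → height packing ≤ s * t) height-p₀
    (height-stretch p₀ 0<s y′ h′ (λ i → bottom-≥ i (Rounded? i)) (λ i → top-≤ i (Rounded? i)))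

  RoundedAt : ∀ i → Dec (Rounded i) → ℕ → Set
  RoundedAt i d l = (Σ ℕ λ kᵢ → m ℕ.≤ kᵢ × kᵢ ℕ.≤ m ℕ.* m
                      × roundedHeight i d ≡ ℕ→ℚ kᵢ * grid l × hℚ I i ≤ roundedHeight i d)
                  × (Σ ℤ λ z → roundedBottom i d ≡ ℤ→ℚ z * grid l)

  rounded-spec : ∀ i d l → S i → l ℕ.≤ k → HeightClass l (hℚ I i) → RoundedAt i d l
  rounded-spec i (no ¬r) l sᵢ l≤k c = ⊥-elim (¬r (sᵢ , l , l≤k , c))
  rounded-spec i (yes r@(_ , l , _ , c)) l′ _ _ c′ =
    subst (RoundedAt i (yes r)) (HeightClass-unique {l = l} {l′} c c′)
      ((K , proj₁ bounds , proj₂ bounds , refl , h≤Kg) , (+ proj₁ Y-spec , refl))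
    where
    Y-spec : RoundedUp (s * y i) (grid l)
    Y-spec = roundUp (s*y≥0 i) (grid-pos i l)
    K-spec : RoundedUp (hℚ I i) (grid l)
    K-spec = roundUp (ℕ→ℚ-nonNeg (h i)) (grid-pos i l)
    K = proj₁ K-spec
    h≤Kg = proj₁ (proj₂ K-spec)
    bounds = multiplier-bounds {l} (grid-pos i l) c h≤Kg (proj₂ (proj₂ K-spec))

  unrounded-spec : ∀ i d → ¬ Rounded i → roundedHeight i d ≡ hℚ I i
  unrounded-spec i (yes r) ¬r = ⊥-elim (¬r r)
  unrounded-spec i (no _)  _  = refl

lemma2 : (m : ℕ) → .{{_ : NonZero m}} → 2 ℕ.≤ m → (k : ℕ) → (μ : ℚ) →
    0ℚ < μ → μ < ((+ 1 / m) ^ℚ k) →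
    (I : Instance) → (OPT : ℚ) → IsOPT I OPT →
    Σ (Fin (Instance.n I) → ℚ) λ h′ →
    Σ (Packing (Instance.W I) (Instance.n I) (wℚ I) h′) λ p →
      height p ≤ (ℕ→ℚ 1 + (+ 2 / m)) * OPT
      × (∀ (i : Fin (Instance.n I)) → (l : ℕ) →
          (Large I ((+ 1 / m) ^ℚ k) OPT i
              ⊎ Tall I ((+ 1 / m) ^ℚ k) (+ 1 / m) OPT i
              ⊎ Vertical I ((+ 1 / m) ^ℚ k) μ (+ 1 / m) OPT i) →
          l ℕ.≤ k →
          ((+ 1 / m) ^ℚ l) * OPT ≤ hℚ I i →
          hℚ I i < ((+ 1 / m) ^ℚ l) * ℕ→ℚ m * OPT →
            (Σ ℕ λ kᵢ → m ℕ.≤ kᵢ × kᵢ ℕ.≤ m ℕ.* m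
                × h′ i ≡ ℕ→ℚ kᵢ * (((+ 1 / m) ^ℚ (ℕ.suc l)) * OPT)
                × hℚ I i ≤ h′ i)
            × (Σ ℤ λ z → Packing.y p i ≡ ℤ→ℚ z * (((+ 1 / m) ^ℚ (ℕ.suc l)) * OPT)))
      × (∀ (i : Fin (Instance.n I)) →
          ¬ ((Large I ((+ 1 / m) ^ℚ k) OPT i
              ⊎ Tall I ((+ 1 / m) ^ℚ k) (+ 1 / m) OPT i
              ⊎ Vertical I ((+ 1 / m) ^ℚ k) μ (+ 1 / m) OPT i)
           × (Σ ℕ λ l → l ℕ.≤ k
              × ((+ 1 / m) ^ℚ l) * OPT ≤ hℚ I i
              × hℚ I i < ((+ 1 / m) ^ℚ l) * ℕ→ℚ m * OPT)) →
          h′ i ≡ hℚ I i)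
lemma2 (suc m′) _ k μ _ _ I OPT ((p₀ , height-p₀) , _) =
  h′ , packing , height-packing ,
  (λ i l sᵢ l≤k lo hi → rounded-spec i (Rounded? i) l sᵢ l≤k (lo , hi)) ,
  (λ i ¬r → unrounded-spec i (Rounded? i) ¬r)
  where
  ε = + 1 / suc m′
  δ = ε ^ℚ k
  open Rounding m′ k I OPT p₀ height-p₀
    (λ i → Large? I δ OPT i ⊎-dec Tall? I δ ε OPT i ⊎-dec Vertical? I δ μ ε OPT i)
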